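{- Fix a string $\hat Q$, integers $k\ge0$ and $\Delta>0$, and a normalized weight function $w:\bar\Sigma^2\to[0,W]$. Let $\mathcal{I}=(U_1,V_1)(U_2,V_2)\cdots(U_z,V_z)$ be a sequence of pairs of strings such that $U_1,\dots,U_z$ and $V_1,\dots,V_z$ are both $\Delta$-puzzles and $\sum_{i=1}^z\big||U_i|-|V_i|\big|\le\Delta/2-k$. Let $\mathrm{Plain}(\mathcal{I})\subseteq\{(U_i,V_i): 1<i<z,\ U_i=V_i=\hat Q\}$ be a set of pairs labelled plain. Suppose $\mathcal{I}$ contains a maximal contiguous block $\mathcal{X}=(U_x,V_x)\cdots(U_{x+k'},V_{x+k'})$ of internal pairs (i.e. with indices in $(1,z)$) all belonging to $\mathrm{Plain}(\mathcal{I})$, where $k'\ge k+1$. Let $\mathcal{I}^-$ be obtained from $\mathcal{I}$ by replacing $\mathcal{X}$ with $(U_x,V_x)\cdots(U_{x+k'-1},V_{x+k'-1})$, and $\mathcal{I}^+$ by replacing $\mathcal{X}$ with $\mathcal{X}$ followed by $(\hat Q,\hat Q)$. Then $\mathrm{Occ}^w_k(\mathcal{I})\subseteq\mathrm{Occ}^w_k(\mathcal{I}^-)$ and $\mathrm{Occ}^w_k(\mathcal{I})\subseteq\mathrm{Occ}^w_k(\mathcal{I}^+)$.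
   Context: $\bar\Sigma=\Sigma\cup\{\varepsilon\}$; normalized means $w(a,a)=0$ and $w(a,b)\ge1$ for $a\ne b$; $\mathsf{ed}^w(X\to Y)$ is the minimum total cost of edits (deletion of $a$: $w(a,\varepsilon)$, insertion of $b$: $w(\varepsilon,b)$, substitution: $w(a,b)$) transforming $X$ into $Y$; $\mathrm{Occ}^w_k(P,T)=\{i:\exists j\ge i,\ \mathsf{ed}^w(P\to T[i..j))\le k\}$. Strings $S_1,\dots,S_z$ ($z\ge2$) form a $\Delta$-puzzle if $|S_i|\ge\Delta$ for all $i$ and $S_i[|S_i|-\Delta..|S_i|)=S_{i+1}[0..\Delta)$ for all $i<z$; its value is $\mathrm{val}_\Delta(S_1,\dots,S_z)=S_1\cdot S_2[\Delta..|S_2|)\cdots S_z[\Delta..|S_z|)$. For a sequence $\mathcal{J}=(U_1,V_1)\cdots(U_z,V_z)$ whose components form $\Delta$-puzzles, $\mathrm{Occ}^w_k(\mathcal{J})=\mathrm{Occ}^w_k(\mathrm{val}_\Delta(U_1,\dots,U_z),\mathrm{val}_\Delta(V_1,\dots,V_z))$.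
   Formalization: The weight function w takes rational values, and its bound W is rational. -}

module Defs where

open import Data.Nat using (ℕ; zero; suc; _+_; _*_; _∸_; _≤_; _<_)
open import Data.Integer using (+_)
open import Data.List using (List; []; _∷_; _++_; length; map; concat; take; drop)
open import Data.Maybe using (Maybe; just; nothing)
open import Data.Product using (_×_; Σ; ∃; _,_; proj₁; proj₂)
open import Data.Rational using (ℚ; 0ℚ; 1ℚ; _/_) renaming (_+_ to _+ℚ_; _≤_ to _≤ℚ_)
open import Relation.Binary.PropositionalEquality using (_≡_; _≢_)

-- Σ̄ = Σ ∪ {ε} is represented as Maybe A (nothing = ε).
Weight : Set → Set
Weight A = Maybe A → Maybe A → ℚ

ℕtoℚ : ℕ → ℚ
ℕtoℚ n = + n / 1

record NormalizedBy {A : Set} (w : Weight A) (W : ℚ) : Set where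
  field
    w-refl  : ∀ a → w a a ≡ 0ℚ
    w-ge1   : ∀ a b → a ≢ b → 1ℚ ≤ℚ w a b
    w-nonneg : ∀ a b → 0ℚ ≤ℚ w a b
    w-bound : ∀ a b → w a b ≤ℚ W

-- Alignment X → Y of total cost c (each character deleted, inserted, or
-- substituted/matched exactly once).  ed^w(X → Y) is the minimum such c.
data Alignment {A : Set} (w : Weight A) : List A → List A → ℚ → Set where
  nil : Alignment w [] [] 0ℚ
  del : ∀ {a xs ys c} → Alignment w xs ys c →
        Alignment w (a ∷ xs) ys (w (just a) nothing +ℚ c)
  ins : ∀ {b xs ys c} → Alignment w xs ys c →
        Alignment w xs (b ∷ ys) (w nothing (just b) +ℚ c)
  sub : ∀ {a b xs ys c} → Alignment w xs ys c →
        Alignment w (a ∷ xs) (b ∷ ys) (w (just a) (just b) +ℚ c)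

-- ed^w(X → Y) ≤ k  (the minimum cost is ≤ k iff some alignment costs ≤ k)
EdAtMost : {A : Set} → Weight A → List A → List A → ℚ → Set
EdAtMost w X Y k = Σ ℚ (λ c → Alignment w X Y c × c ≤ℚ k)

slice : {A : Set} → List A → ℕ → ℕ → List A
slice T i j = take (j ∸ i) (drop i T)

Occ : {A : Set} → Weight A → ℕ → List A → List A → ℕ → Set
Occ w k P T i = Σ ℕ (λ j → i ≤ j × j ≤ length T × EdAtMost w P (slice T i j) (ℕtoℚ k))

data Chain {A : Set} (Δ : ℕ) : List (List A) → Set where
  one  : ∀ {S} → Δ ≤ length S → Chain Δ (S ∷ [])
  cons : ∀ {S T Ss} → Δ ≤ length S →
         drop (length S ∸ Δ) S ≡ take Δ T →
         Chain Δ (T ∷ Ss) → Chain Δ (S ∷ T ∷ Ss)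

IsPuzzle : {A : Set} → ℕ → List (List A) → Set
IsPuzzle Δ Ss = 2 ≤ length Ss × Chain Δ Ss

val : {A : Set} → ℕ → List (List A) → List A
val Δ [] = []
val Δ (S ∷ Ss) = S ++ concat (map (drop Δ) Ss)

OccSeq : {A : Set} → Weight A → ℕ → ℕ → List (List A × List A) → ℕ → Set
OccSeq w k Δ J = Occ w k (val Δ (map proj₁ J)) (val Δ (map proj₂ J))

lenDiffSum : {A : Set} → List (List A × List A) → ℕ
lenDiffSum [] = 0
lenDiffSum ((U , V) ∷ J) = ((length U ∸ length V) + (length V ∸ length U)) + lenDiffSum J

-- 0-based lookup
at : {B : Set} → List B → ℕ → Maybe B
at [] _ = nothing
at (x ∷ xs) zero = just x
at (x ∷ xs) (suc n) = at xs n

module Submission where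

-- Both values have the shape G ++ Sₘ ++ C, where Sₘ = Q̂[0..Δ) · Q̂[Δ..)ᵐ is contributed by a run of m
-- plain pairs; with u = Q̂[0..|Q̂|-Δ) and v = Q̂[Δ..) one has Sₘ₊₁ = u ++ Sₘ = Sₘ ++ v, so in Sₘ₊₁
-- deleting or doubling any factor of length |u| gives Sₘ or Sₘ₊₂. Take a k-error alignment of the
-- pattern with a text factor and cut k + 1 consecutive blocks of length |u| out of the periodic part
-- of the pattern. Deletions, insertions and substitutions of distinct letters cost at least 1, so
-- some block is aligned at cost 0 to a text factor of the same length. As the pieces of the two
-- puzzles differ in total length by at most Δ/2 - k, that text factor lies inside the periodic part
-- of the text too; deleting or doubling both blocks keeps an alignment of the same cost between the
-- values of I⁻ (resp. I⁺).

open import Defs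
import Algebra.Solver.Monoid as MonoidSolver
open import Data.Empty using (⊥-elim)
import Data.Integer as ℤ
import Data.Integer.Properties as ℤ
open import Data.List using (List; []; _∷_; _++_; length; map; take; drop; concat; replicate)
open import Data.List.Properties
  using ( ∷-injective; ++-assoc; ++-identityʳ; ++-monoid; length-++; length-++-≤ˡ; length-++-≤ʳ
        ; length-take; length-drop; take++drop≡id; drop-drop; map-++; concat-++; map-replicate )
open import Data.Maybe using (just; nothing)
open import Data.Nat using (ℕ; zero; suc; _+_; _*_; _∸_; _≤_; _<_; z≤n; s≤s)
import Data.Nat.Coprimality as Coprime
import Data.Nat.Properties as ℕ
open import Data.Nat.Solver using (module +-*-Solver)
open import Data.Product using (_×_; _,_; proj₁; proj₂; ∃-syntax)
open import Data.Rational using (ℚ; 0ℚ; 1ℚ; mkℚ; toℚᵘ; -_; *≤*; _<?_)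
  renaming (_+_ to _+ℚ_; _≤_ to _≤ℚ_; _<_ to _<ℚ_)
import Data.Rational.Properties as ℚ
import Data.Rational.Unnormalised as ℚᵘ
import Data.Rational.Unnormalised.Properties as ℚᵘ
open import Relation.Binary.PropositionalEquality
open import Relation.Nullary using (¬_; yes; no)

module ++-Solver (A : Set) = MonoidSolver (++-monoid A)

m+n∸o≤m∸o+n : ∀ m n o → (m + n) ∸ o ≤ (m ∸ o) + n
m+n∸o≤m∸o+n zero    n zero    = ℕ.≤-refl
m+n∸o≤m∸o+n zero    n (suc o) = ℕ.m∸n≤m n (suc o)
m+n∸o≤m∸o+n (suc m) n zero    = ℕ.≤-refl
m+n∸o≤m∸o+n (suc m) n (suc o) = m+n∸o≤m∸o+n m n o

+-monoˡ-≤-+ : ∀ {m} n d k → m ≤ n + d → m + k ≤ n + (d + k)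
+-monoˡ-≤-+ {m} n d k m≤n+d = subst (m + k ≤_) (ℕ.+-assoc n d k) (ℕ.+-monoˡ-≤ k m≤n+d)

margins-fit : ∀ {Δ D} DL DR k k′ p → D ≡ DL + DR → 2 * (D + k) ≤ Δ → k ≤ k′ →
              (DL + k) + suc k * p + (DR + k) ≤ Δ + suc k′ * p
margins-fit {Δ} {D} DL DR k k′ p refl budget k≤k′ = begin
  (DL + k) + suc k * p + (DR + k) ≡⟨ solve 4 (λ l r k s → (l :+ k) :+ s :+ (r :+ k) := ((l :+ r) :+ (k :+ k)) :+ s)
                                            refl DL DR k (suc k * p) ⟩
  (D + (k + k)) + suc k * p       ≤⟨ ℕ.+-mono-≤ D+2k≤Δ (ℕ.*-monoˡ-≤ p (s≤s k≤k′)) ⟩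
  Δ + suc k′ * p                  ∎
  where
  open ℕ.≤-Reasoning
  open +-*-Solver using (solve; _:=_; _:+_; _:*_; con)
  D+2k≤Δ : D + (k + k) ≤ Δ
  D+2k≤Δ = ℕ.≤-trans (ℕ.m≤m+n _ D)
             (subst (_≤ Δ) (solve 2 (λ d k → con 2 :* (d :+ k) := (d :+ (k :+ k)) :+ d) refl D k) budget)

ℕtoℚ-suc : ∀ n → ℕtoℚ (suc n) ≡ 1ℚ +ℚ ℕtoℚ n
ℕtoℚ-suc n = ℚ.toℚᵘ-injective (ℚᵘ.≃-trans suc≃ (ℚᵘ.≃-sym (ℚ.toℚᵘ-homo-+ 1ℚ (ℕtoℚ n))))
  where
  ℕtoℚ≡mkℚ : ∀ m → ℕtoℚ m ≡ mkℚ (ℤ.+ m) 0 (Coprime.sym (Coprime.1-coprimeTo m))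
  ℕtoℚ≡mkℚ m = ℚ.normalize-coprime (Coprime.sym (Coprime.1-coprimeTo m))
  suc≃ : toℚᵘ (ℕtoℚ (suc n)) ℚᵘ.≃ toℚᵘ 1ℚ ℚᵘ.+ toℚᵘ (ℕtoℚ n)
  suc≃ rewrite ℕtoℚ≡mkℚ n | ℕtoℚ≡mkℚ (suc n) | ℕ.*-identityʳ n | ℤ.+◃n≡+n n = ℚᵘ.*≡* refl

p≤q+p : ∀ {q} p → 0ℚ ≤ℚ q → p ≤ℚ q +ℚ p
p≤q+p {q} p 0≤q = subst (_≤ℚ q +ℚ p) (ℚ.+-identityˡ p) (ℚ.+-monoˡ-≤ p 0≤q)

p≤p+q : ∀ p {q} → 0ℚ ≤ℚ q → p ≤ℚ p +ℚ q
p≤p+q p {q} 0≤q = subst (_≤ℚ p +ℚ q) (ℚ.+-identityʳ p) (ℚ.+-monoʳ-≤ p 0≤q)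

+-cancelˡ-≤ : ∀ r {p q} → r +ℚ p ≤ℚ r +ℚ q → p ≤ℚ q
+-cancelˡ-≤ r {p} {q} r+p≤r+q = subst₂ _≤ℚ_ (-r+[r+x]≡x p) (-r+[r+x]≡x q) (ℚ.+-monoʳ-≤ (- r) r+p≤r+q)
  where
  -r+[r+x]≡x : ∀ x → (- r) +ℚ (r +ℚ x) ≡ x
  -r+[r+x]≡x x = trans (sym (ℚ.+-assoc (- r) r x)) (trans (cong (_+ℚ x) (ℚ.+-inverseˡ r)) (ℚ.+-identityˡ x))

+-reassoc : ∀ d {c c₁ c₂} → c ≡ c₁ +ℚ c₂ → d +ℚ c ≡ (d +ℚ c₁) +ℚ c₂
+-reassoc d {c₁ = c₁} {c₂} refl = sym (ℚ.+-assoc d c₁ c₂)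

1≤p+q : ∀ {p q} → 1ℚ ≤ℚ p → 0ℚ ≤ℚ q → 1ℚ ≤ℚ p +ℚ q
1≤p+q {p} 1≤p 0≤q = ℚ.≤-trans 1≤p (p≤p+q p 0≤q)

1≰0 : ¬ (1ℚ ≤ℚ 0ℚ)
1≰0 (*≤* (ℤ.+≤+ ()))

1≤p⇒p≮1 : ∀ {p} → 1ℚ ≤ℚ p → ¬ (p <ℚ 1ℚ)
1≤p⇒p≮1 1≤p p<1 = ℚ.<-irrefl refl (ℚ.≤-<-trans 1≤p p<1)

p+q≤1+k⇒q≤k : ∀ {p q} k → 1ℚ ≤ℚ p → p +ℚ q ≤ℚ ℕtoℚ (suc k) → q ≤ℚ ℕtoℚ k
p+q≤1+k⇒q≤k {p} {q} k 1≤p p+q≤1+k =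
  +-cancelˡ-≤ 1ℚ (ℚ.≤-trans (ℚ.+-monoˡ-≤ q 1≤p) (subst (p +ℚ q ≤ℚ_) (ℕtoℚ-suc k) p+q≤1+k))

module _ {A : Set} where

  ++-cancel-length : ∀ (xs ys : List A) {zs ws} →
                     length xs ≡ length ys → xs ++ zs ≡ ys ++ ws → xs ≡ ys × zs ≡ ws
  ++-cancel-length []       []       _   eq = refl , eq
  ++-cancel-length (x ∷ xs) (y ∷ ys) len eq with ∷-injective eq
  ... | refl , eq′ with ++-cancel-length xs ys (ℕ.suc-injective len) eq′
  ...   | refl , zs≡ws = refl , zs≡ws

  ++-split-≤ : ∀ (xs zs : List A) {ys ws} →
               length xs ≤ length zs → xs ++ ys ≡ zs ++ ws → ∃[ m ] zs ≡ xs ++ m × ys ≡ m ++ ws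
  ++-split-≤ []       zs       _        eq = zs , refl , eq
  ++-split-≤ (x ∷ xs) (z ∷ zs) (s≤s le) eq with ∷-injective eq
  ... | refl , eq′ with ++-split-≤ xs zs le eq′
  ...   | m , zs≡ , ys≡ = m , cong (x ∷_) zs≡ , ys≡

  ++-prefix-≤ : ∀ (xs zs : List A) {ys ws} → xs ++ ys ≡ zs ++ ws → length ws ≤ length ys →
                length xs ≤ length zs
  ++-prefix-≤ xs zs {ys} {ws} eq |ws|≤|ys| = ℕ.+-cancelʳ-≤ (length ys) _ _ (begin
    length xs + length ys ≡⟨ sym (length-++ xs) ⟩
    length (xs ++ ys)     ≡⟨ cong length eq ⟩
    length (zs ++ ws)     ≡⟨ length-++ zs ⟩
    length zs + length ws ≤⟨ ℕ.+-monoʳ-≤ (length zs) |ws|≤|ys| ⟩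
    length zs + length ys ∎)
    where open ℕ.≤-Reasoning

  length-++₃ : ∀ (xs ys zs : List A) → length (xs ++ ys ++ zs) ≡ length xs + (length ys + length zs)
  length-++₃ xs ys zs = trans (length-++ xs) (cong (length xs +_) (length-++ ys))

  length-++-swap : ∀ (u X W : List A) → length W ≡ length u → length (u ++ X) ≡ length (X ++ W)
  length-++-swap u X W |W|≡|u| = begin
    length (u ++ X)     ≡⟨ length-++ u ⟩
    length u + length X ≡⟨ ℕ.+-comm (length u) (length X) ⟩
    length X + length u ≡⟨ cong (length X +_) (sym |W|≡|u|) ⟩
    length X + length W ≡⟨ sym (length-++ X) ⟩
    length (X ++ W)     ∎
    where open ≡-Reasoning

  length-take-≤ : ∀ n (xs : List A) → n ≤ length xs → length (take n xs) ≡ n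
  length-take-≤ n xs n≤|xs| = trans (length-take n xs) (ℕ.m≤n⇒m⊓n≡m n≤|xs|)

  length-drop-≥ : ∀ n {m} (xs : List A) → n + m ≤ length xs → m ≤ length (drop n xs)
  length-drop-≥ n {m} xs n+m≤|xs| = subst (m ≤_) (sym (length-drop n xs))
    (ℕ.m+n≤o⇒m≤o∸n m (subst (_≤ length xs) (ℕ.+-comm n m) n+m≤|xs|))

  take-length-++ : ∀ (xs ys : List A) → take (length xs) (xs ++ ys) ≡ xs
  take-length-++ []       ys = refl
  take-length-++ (x ∷ xs) ys = cong (x ∷_) (take-length-++ xs ys)

  drop-length-++ : ∀ (xs ys : List A) → drop (length xs) (xs ++ ys) ≡ ys
  drop-length-++ []       ys = refl
  drop-length-++ (x ∷ xs) ys = drop-length-++ xs ys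

  slice-factor : ∀ (T : List A) {i j} → i ≤ j → j ≤ length T → T ≡ take i T ++ slice T i j ++ drop j T
  slice-factor T {i} {j} i≤j j≤|T| = begin
    T                                                  ≡⟨ sym (take++drop≡id i T) ⟩
    take i T ++ drop i T                               ≡⟨ cong (take i T ++_) (sym (take++drop≡id (j ∸ i) (drop i T))) ⟩
    take i T ++ slice T i j ++ drop (j ∸ i) (drop i T) ≡⟨ cong (λ Z → take i T ++ slice T i j ++ Z) drops ⟩
    take i T ++ slice T i j ++ drop j T                ∎
    where
    open ≡-Reasoning
    drops : drop (j ∸ i) (drop i T) ≡ drop j T
    drops = trans (drop-drop i (j ∸ i) T) (cong (λ n → drop n T) (ℕ.m+[n∸m]≡n i≤j))

  map-block : ∀ {B : Set} (f : B → List A) (L : List B) m x R →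
              map f (L ++ replicate m x ++ R) ≡ map f L ++ replicate m (f x) ++ map f R
  map-block f L m x R = trans (map-++ f L _)
    (cong (map f L ++_) (trans (map-++ f (replicate m x) R) (cong (_++ map f R) (map-replicate f m x))))

  length-concat-replicate : ∀ m (V : List A) → length (concat (replicate m V)) ≡ m * length V
  length-concat-replicate zero    V = refl
  length-concat-replicate (suc m) V = trans (length-++ V) (cong (length V +_) (length-concat-replicate m V))

  at-++ʳ : ∀ (xs ys : List A) n → at (xs ++ ys) (length xs + n) ≡ at ys n
  at-++ʳ []       ys n = refl
  at-++ʳ (x ∷ xs) ys n = at-++ʳ xs ys n

  at-++⇒replicate : ∀ (X R : List A) x → (∀ q → q < length X → at (X ++ R) q ≡ just x) →
                    X ≡ replicate (length X) x
  at-++⇒replicate []      R x _    = refl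
  at-++⇒replicate (y ∷ X) R x at≡x with at≡x 0 (s≤s z≤n)
  ... | refl = cong (y ∷_) (at-++⇒replicate X R x (λ q q< → at≡x (suc q) (s≤s q<)))

  take-replicate-suc : ∀ m (x : A) → take m (replicate (suc m) x) ≡ replicate m x
  take-replicate-suc zero    x = refl
  take-replicate-suc (suc m) x = cong (x ∷_) (take-replicate-suc m x)

  replicate-++-∷ : ∀ m (x : A) R → replicate m x ++ x ∷ R ≡ replicate (suc m) x ++ R
  replicate-++-∷ zero    x R = refl
  replicate-++-∷ (suc m) x R = cong (x ∷_) (replicate-++-∷ m x R)

  run⇒replicate : ∀ (L X R : List A) x {n} → length X ≡ n →
                  (∀ q → q < n → at (L ++ X ++ R) (length L + q) ≡ just x) → X ≡ replicate n x
  run⇒replicate L X R x refl at≡x =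
    at-++⇒replicate X R x (λ q q< → trans (sym (at-++ʳ L (X ++ R) q)) (at≡x q q<))

-- Windows in periodic words

module _ {A : Set} where

  -- u ++ S ≡ S ++ v says that S has period |u|, so that any factor of length |u| may be deleted from
  -- u ++ S, or doubled in S, without leaving the family of such words.

  conj-insert : ∀ {u v S} (X W Y : List A) → u ++ S ≡ S ++ v → S ≡ X ++ W ++ Y → length W ≡ length u →
                u ++ S ≡ X ++ W ++ W ++ Y
  conj-insert {u} {v} X W Y conj refl |W|≡|u| = begin
    u ++ X ++ W ++ Y   ≡⟨ solve 4 (λ u x w y → u ⊕ x ⊕ w ⊕ y ⊜ (u ⊕ x) ⊕ w ⊕ y) refl u X W Y ⟩
    (u ++ X) ++ W ++ Y ≡⟨ cong (_++ W ++ Y) uX≡XW ⟩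
    (X ++ W) ++ W ++ Y ≡⟨ ++-assoc X W _ ⟩
    X ++ W ++ W ++ Y   ∎
    where
    open ≡-Reasoning
    open ++-Solver A using (solve; _⊜_; _⊕_)
    uX≡XW : u ++ X ≡ X ++ W
    uX≡XW = proj₁ (++-cancel-length (u ++ X) (X ++ W) (length-++-swap u X W |W|≡|u|) (begin
      (u ++ X) ++ W ++ Y ≡⟨ ++-assoc u X _ ⟩
      u ++ X ++ W ++ Y   ≡⟨ conj ⟩
      (X ++ W ++ Y) ++ v ≡⟨ solve 4 (λ x w y v → (x ⊕ w ⊕ y) ⊕ v ⊜ (x ⊕ w) ⊕ y ⊕ v) refl X W Y v ⟩
      (X ++ W) ++ Y ++ v ∎))

  conj-delete : ∀ {u v S} (X W Y : List A) → u ++ S ≡ S ++ v → u ++ S ≡ X ++ W ++ Y → length W ≡ length u →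
                S ≡ X ++ Y
  conj-delete {u} {v} {S} X W Y conj uS≡XWY |W|≡|u| = trans S≡XM (cong (X ++_) M≡Y)
    where
    open ≡-Reasoning
    |X|+|Y|≡|S| : length X + length Y ≡ length S
    |X|+|Y|≡|S| = ℕ.+-cancelˡ-≡ (length u) _ _ (begin
      length u + (length X + length Y) ≡⟨ solve 3 (λ u x y → u :+ (x :+ y) := x :+ (u :+ y))
                                                  refl (length u) (length X) (length Y) ⟩
      length X + (length u + length Y) ≡⟨ cong (λ n → length X + (n + length Y)) (sym |W|≡|u|) ⟩
      length X + (length W + length Y) ≡⟨ sym (length-++₃ X W Y) ⟩
      length (X ++ W ++ Y)             ≡⟨ cong length (sym uS≡XWY) ⟩
      length (u ++ S)                  ≡⟨ length-++ u ⟩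
      length u + length S              ∎)
      where open +-*-Solver using (solve; _:=_; _:+_)
    split = ++-split-≤ X S (subst (length X ≤_) |X|+|Y|≡|S| (ℕ.m≤m+n (length X) (length Y)))
                       (trans (sym uS≡XWY) conj)
    M = proj₁ split
    S≡XM : S ≡ X ++ M
    S≡XM = proj₁ (proj₂ split)
    M≡Y : M ≡ Y
    M≡Y = proj₂ (++-cancel-length (u ++ X) (X ++ W) (length-++-swap u X W |W|≡|u|) (begin
      (u ++ X) ++ M ≡⟨ ++-assoc u X M ⟩
      u ++ X ++ M   ≡⟨ cong (u ++_) (sym S≡XM) ⟩
      u ++ S        ≡⟨ uS≡XWY ⟩
      X ++ W ++ Y   ≡⟨ sym (++-assoc X W Y) ⟩
      (X ++ W) ++ Y ∎))

  middle-window : ∀ (G S C X W Y : List A) → G ++ S ++ C ≡ X ++ W ++ Y →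
                  length G ≤ length X → length C ≤ length Y →
                  ∃[ X′ ] ∃[ Y′ ] X ≡ G ++ X′ × Y ≡ Y′ ++ C × S ≡ X′ ++ W ++ Y′
  middle-window G S C X W Y GSC≡XWY |G|≤|X| |C|≤|Y|
    with ++-split-≤ G X |G|≤|X| GSC≡XWY
  ... | X′ , X≡GX′ , SC≡X′WY
    with X′WY≡SC ← trans (++-assoc X′ W Y) (sym SC≡X′WY)
    with ++-split-≤ (X′ ++ W) S (++-prefix-≤ (X′ ++ W) S X′WY≡SC |C|≤|Y|) X′WY≡SC
  ... | Y′ , S≡X′WY′ , Y≡Y′C = X′ , Y′ , X≡GX′ , Y≡Y′C , trans S≡X′WY′ (++-assoc X′ W Y′)

  window-suffix-margin : ∀ (G S C X B Y : List A) {d e} → G ++ S ++ C ≡ X ++ B ++ Y →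
                         length X + length B ≤ length G + d → d + e ≤ length S → length C + e ≤ length Y
  window-suffix-margin G S C X B Y {d} {e} eq XB≤Gd d+e≤S = ℕ.+-cancelˡ-≤ (length X + length B) _ _ (begin
    (length X + length B) + (length C + e) ≤⟨ ℕ.+-monoˡ-≤ (length C + e) XB≤Gd ⟩
    (length G + d) + (length C + e)        ≡⟨ solve 4 (λ g d c e → (g :+ d) :+ (c :+ e) := g :+ ((d :+ e) :+ c))
                                                      refl (length G) d (length C) e ⟩
    length G + ((d + e) + length C)        ≤⟨ ℕ.+-monoʳ-≤ (length G) (ℕ.+-monoˡ-≤ (length C) d+e≤S) ⟩
    length G + (length S + length C)       ≡⟨ sym (length-++₃ G S C) ⟩
    length (G ++ S ++ C)                   ≡⟨ cong length eq ⟩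
    length (X ++ B ++ Y)                   ≡⟨ length-++₃ X B Y ⟩
    length X + (length B + length Y)       ≡⟨ sym (ℕ.+-assoc (length X) (length B) (length Y)) ⟩
    (length X + length B) + length Y       ∎)
    where
    open ℕ.≤-Reasoning
    open +-*-Solver using (solve; _:=_; _:+_)

  delete-middle-window : ∀ {u v S S′} (G C X W Y : List A) → u ++ S ≡ S ++ v → S′ ≡ u ++ S →
                         G ++ S′ ++ C ≡ X ++ W ++ Y → length W ≡ length u →
                         length G ≤ length X → length C ≤ length Y → X ++ Y ≡ G ++ S ++ C
  delete-middle-window {S = S} G C X W Y conj S′≡uS eq |W|≡|u| |G|≤|X| |C|≤|Y|
    with middle-window G _ C X W Y eq |G|≤|X| |C|≤|Y|
  ... | X′ , Y′ , refl , refl , S′≡X′WY′ = begin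
    (G ++ X′) ++ Y′ ++ C ≡⟨ solve 4 (λ g x y c → (g ⊕ x) ⊕ y ⊕ c ⊜ g ⊕ (x ⊕ y) ⊕ c)
                                    refl G X′ Y′ C ⟩
    G ++ (X′ ++ Y′) ++ C ≡⟨ cong (λ Z → G ++ Z ++ C) (sym S≡X′Y′) ⟩
    G ++ S ++ C          ∎
    where
    open ≡-Reasoning
    open ++-Solver A using (solve; _⊜_; _⊕_)
    S≡X′Y′ : S ≡ X′ ++ Y′
    S≡X′Y′ = conj-delete X′ W Y′ conj (trans (sym S′≡uS) S′≡X′WY′) |W|≡|u|

  insert-middle-window : ∀ {u v S S′} (G C X W Y : List A) → u ++ S ≡ S ++ v → S′ ≡ u ++ S →
                         G ++ S ++ C ≡ X ++ W ++ Y → length W ≡ length u →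
                         length G ≤ length X → length C ≤ length Y → X ++ W ++ W ++ Y ≡ G ++ S′ ++ C
  insert-middle-window {S′ = S′} G C X W Y conj S′≡uS eq |W|≡|u| |G|≤|X| |C|≤|Y|
    with middle-window G _ C X W Y eq |G|≤|X| |C|≤|Y|
  ... | X′ , Y′ , refl , refl , S≡X′WY′ = begin
    (G ++ X′) ++ W ++ W ++ Y′ ++ C ≡⟨ solve 5 (λ g x w y c → (g ⊕ x) ⊕ w ⊕ w ⊕ y ⊕ c ⊜ g ⊕ (x ⊕ w ⊕ w ⊕ y) ⊕ c)
                                              refl G X′ W Y′ C ⟩
    G ++ (X′ ++ W ++ W ++ Y′) ++ C ≡⟨ cong (λ Z → G ++ Z ++ C) (sym S′≡X′WWY′) ⟩
    G ++ S′ ++ C                   ∎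
    where
    open ≡-Reasoning
    open ++-Solver A using (solve; _⊜_; _⊕_)
    S′≡X′WWY′ : S′ ≡ X′ ++ W ++ W ++ Y′
    S′≡X′WWY′ = trans S′≡uS (conj-insert X′ W Y′ conj S≡X′WY′ |W|≡|u|)

-- Alignments

module _ {A : Set} {w : Weight A} where

  _++ᴬ_ : ∀ {X₁ Y₁ c₁ X₂ Y₂ c₂} → Alignment w X₁ Y₁ c₁ → Alignment w X₂ Y₂ c₂ →
          Alignment w (X₁ ++ X₂) (Y₁ ++ Y₂) (c₁ +ℚ c₂)
  _++ᴬ_ {c₂ = c₂} nil β = subst (Alignment w _ _) (sym (ℚ.+-identityˡ c₂)) β
  _++ᴬ_ {c₂ = c₂} (del {a = a} {c = c} α) β =
    subst (Alignment w _ _) (sym (ℚ.+-assoc (w (just a) nothing) c c₂)) (del (α ++ᴬ β))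
  _++ᴬ_ {c₂ = c₂} (ins {b = b} {c = c} α) β =
    subst (Alignment w _ _) (sym (ℚ.+-assoc (w nothing (just b)) c c₂)) (ins (α ++ᴬ β))
  _++ᴬ_ {c₂ = c₂} (sub {a = a} {b = b} {c = c} α) β =
    subst (Alignment w _ _) (sym (ℚ.+-assoc (w (just a) (just b)) c c₂)) (sub (α ++ᴬ β))

  record SplitAlignment (X₁ X₂ Y : List A) (c : ℚ) : Set where
    field
      {Y₁ Y₂} : List A
      {c₁ c₂} : ℚ
      Y≡ : Y ≡ Y₁ ++ Y₂
      c≡ : c ≡ c₁ +ℚ c₂
      α₁ : Alignment w X₁ Y₁ c₁
      α₂ : Alignment w X₂ Y₂ c₂

  splitAlignment : ∀ X₁ {X₂ Y c} → Alignment w (X₁ ++ X₂) Y c → SplitAlignment X₁ X₂ Y c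
  splitAlignment [] α = record { Y≡ = refl ; c≡ = sym (ℚ.+-identityˡ _) ; α₁ = nil ; α₂ = α }
  splitAlignment (x ∷ X₁) (del α) = let open SplitAlignment (splitAlignment X₁ α) in
    record { Y≡ = Y≡ ; c≡ = +-reassoc (w (just x) nothing) c≡ ; α₁ = del α₁ ; α₂ = α₂ }
  splitAlignment (x ∷ X₁) (ins {b = y} α) = let open SplitAlignment (splitAlignment (x ∷ X₁) α) in
    record { Y≡ = cong (y ∷_) Y≡ ; c≡ = +-reassoc (w nothing (just y)) c≡ ; α₁ = ins α₁ ; α₂ = α₂ }
  splitAlignment (x ∷ X₁) (sub {b = y} α) = let open SplitAlignment (splitAlignment X₁ α) in
    record { Y≡ = cong (y ∷_) Y≡ ; c≡ = +-reassoc (w (just x) (just y)) c≡ ; α₁ = sub α₁ ; α₂ = α₂ }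

  factor⇒Occ : ∀ {k P T Tˡ Y Tʳ i} → T ≡ Tˡ ++ Y ++ Tʳ → length Tˡ ≡ i →
               EdAtMost w P Y (ℕtoℚ k) → Occ w k P T i
  factor⇒Occ {P = P} {Tˡ = Tˡ} {Y} {Tʳ} refl refl ed =
    length Tˡ + length Y , ℕ.m≤m+n _ _ , j≤|T| , subst (λ Z → EdAtMost w P Z _) (sym slice≡Y) ed
    where
    j≤|T| : length Tˡ + length Y ≤ length (Tˡ ++ Y ++ Tʳ)
    j≤|T| = subst (_ ≤_) (sym (length-++ Tˡ)) (ℕ.+-monoʳ-≤ (length Tˡ) (length-++-≤ˡ Y))
    slice≡Y : slice (Tˡ ++ Y ++ Tʳ) (length Tˡ) (length Tˡ + length Y) ≡ Y
    slice≡Y = trans (cong₂ take (ℕ.m+n∸m≡n (length Tˡ) (length Y)) (drop-length-++ Tˡ (Y ++ Tʳ)))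
                    (take-length-++ Y Tʳ)

  record ZeroCostWindow (p lo hi : ℕ) (P Y : List A) (c : ℚ) : Set where
    field
      {Pˡ B Pʳ Yˡ B′ Yʳ} : List A
      {cˡ cʳ} : ℚ
      P≡ : P ≡ Pˡ ++ B ++ Pʳ
      Y≡ : Y ≡ Yˡ ++ B′ ++ Yʳ
      c≡ : c ≡ cˡ +ℚ cʳ
      αˡ : Alignment w Pˡ Yˡ cˡ
      β  : Alignment w B B′ 0ℚ
      αʳ : Alignment w Pʳ Yʳ cʳ
      length-B  : length B ≡ p
      length-B′ : length B′ ≡ p
      lo≤ : lo ≤ length Pˡ
      ≤hi : length Pˡ + p ≤ hi

    deleteWindow : Alignment w (Pˡ ++ Pʳ) (Yˡ ++ Yʳ) c
    deleteWindow = subst (Alignment w _ _) (sym c≡) (αˡ ++ᴬ αʳ)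

    doubleWindow : Alignment w (Pˡ ++ B ++ B ++ Pʳ) (Yˡ ++ B′ ++ B′ ++ Yʳ) c
    doubleWindow = subst (Alignment w _ _) cost≡ (αˡ ++ᴬ (β ++ᴬ (β ++ᴬ αʳ)))
      where
      cost≡ : cˡ +ℚ (0ℚ +ℚ (0ℚ +ℚ cʳ)) ≡ c
      cost≡ = trans (cong (cˡ +ℚ_) (trans (ℚ.+-identityˡ _) (ℚ.+-identityˡ cʳ))) (sym c≡)

  prependWindow : ∀ {P₀ P Y c p lo hi} (s : SplitAlignment P₀ P Y c) →
                  ZeroCostWindow p lo hi P (SplitAlignment.Y₂ s) (SplitAlignment.c₂ s) →
                  ZeroCostWindow p (length P₀ + lo) (length P₀ + hi) (P₀ ++ P) Y c
  prependWindow {P₀} {p = p} {hi = hi} s ω = record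
    { P≡ = trans (cong (P₀ ++_) P≡) (sym (++-assoc P₀ Pˡ _))
    ; Y≡ = trans Y≡′ (trans (cong (Y₁ ++_) Y≡) (sym (++-assoc Y₁ Yˡ _)))
    ; c≡ = trans c≡′ (+-reassoc c₁ c≡)
    ; αˡ = α₁ ++ᴬ αˡ ; β = β ; αʳ = αʳ ; length-B = length-B ; length-B′ = length-B′
    ; lo≤ = subst (_ ≤_) (sym (length-++ P₀)) (ℕ.+-monoʳ-≤ (length P₀) lo≤)
    ; ≤hi = begin
        length (P₀ ++ Pˡ) + p       ≡⟨ cong (_+ p) (length-++ P₀) ⟩
        (length P₀ + length Pˡ) + p ≡⟨ ℕ.+-assoc (length P₀) (length Pˡ) p ⟩
        length P₀ + (length Pˡ + p) ≤⟨ ℕ.+-monoʳ-≤ (length P₀) ≤hi ⟩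
        length P₀ + hi              ∎
    }
    where
    open ℕ.≤-Reasoning
    open ZeroCostWindow ω
    open SplitAlignment s renaming (Y≡ to Y≡′; c≡ to c≡′)

  weakenWindow : ∀ {p lo hi lo′ hi′ P Y c} → lo′ ≤ lo → hi ≤ hi′ →
                 ZeroCostWindow p lo hi P Y c → ZeroCostWindow p lo′ hi′ P Y c
  weakenWindow lo′≤lo hi≤hi′ ω = record
    { P≡ = P≡ ; Y≡ = Y≡ ; c≡ = c≡ ; αˡ = αˡ ; β = β ; αʳ = αʳ
    ; length-B = length-B ; length-B′ = length-B′
    ; lo≤ = ℕ.≤-trans lo′≤lo lo≤ ; ≤hi = ℕ.≤-trans ≤hi hi≤hi′
    }
    where open ZeroCostWindow ω

  record PumpableOccurrence (k p : ℕ) (GP S CP GT CT : List A) (i : ℕ) : Set where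
    field
      {Pˡ B Pʳ Tˡ B′ Tʳ} : List A
      P≡ : GP ++ S ++ CP ≡ Pˡ ++ B ++ Pʳ
      T≡ : GT ++ S ++ CT ≡ Tˡ ++ B′ ++ Tʳ
      length-B  : length B ≡ p
      length-B′ : length B′ ≡ p
      GP≤Pˡ : length GP ≤ length Pˡ
      CP≤Pʳ : length CP ≤ length Pʳ
      GT≤Tˡ : length GT ≤ length Tˡ
      CT≤Tʳ : length CT ≤ length Tʳ
      deleted : Occ w k (Pˡ ++ Pʳ) (Tˡ ++ Tʳ) i
      doubled : Occ w k (Pˡ ++ B ++ B ++ Pʳ) (Tˡ ++ B′ ++ B′ ++ Tʳ) i

module _ {A : Set} {w : Weight A} {W : ℚ} (normalized : NormalizedBy w W) where
  open NormalizedBy normalized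

  del-cost : ∀ a → 1ℚ ≤ℚ w (just a) nothing
  del-cost a = w-ge1 (just a) nothing (λ ())

  ins-cost : ∀ b → 1ℚ ≤ℚ w nothing (just b)
  ins-cost b = w-ge1 nothing (just b) (λ ())

  cost-nonneg : ∀ {X Y c} → Alignment w X Y c → 0ℚ ≤ℚ c
  cost-nonneg nil     = ℚ.≤-refl
  cost-nonneg (del α) = ℚ.≤-trans (cost-nonneg α) (p≤q+p _ (w-nonneg _ _))
  cost-nonneg (ins α) = ℚ.≤-trans (cost-nonneg α) (p≤q+p _ (w-nonneg _ _))
  cost-nonneg (sub α) = ℚ.≤-trans (cost-nonneg α) (p≤q+p _ (w-nonneg _ _))

  length-≤-cost : ∀ k {X Y c} → Alignment w X Y c → c ≤ℚ ℕtoℚ k → length X ≤ length Y + k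
  length-≤-cost k nil _ = z≤n
  length-≤-cost zero (del {a = a} α) c≤0 =
    ⊥-elim (1≰0 (ℚ.≤-trans (1≤p+q (del-cost a) (cost-nonneg α)) c≤0))
  length-≤-cost (suc k) {Y = Y} (del {a = a} {xs = X} α) c≤1+k =
    subst (suc (length X) ≤_) (sym (ℕ.+-suc (length Y) k))
      (s≤s (length-≤-cost k α (p+q≤1+k⇒q≤k k (del-cost a) c≤1+k)))
  length-≤-cost k (ins α) c≤k =
    ℕ.≤-trans (length-≤-cost k α (ℚ.≤-trans (p≤q+p _ (w-nonneg _ _)) c≤k)) (ℕ.n≤1+n _)
  length-≤-cost k (sub α) c≤k =
    s≤s (length-≤-cost k α (ℚ.≤-trans (p≤q+p _ (w-nonneg _ _)) c≤k))

  margin-transfer : ∀ k {g X Y c} → Alignment w X Y c → c ≤ℚ ℕtoℚ k → g + k ≤ length X → g ≤ length Y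
  margin-transfer k {g} α c≤k g+k≤|X| = ℕ.+-cancelʳ-≤ k g _ (ℕ.≤-trans g+k≤|X| (length-≤-cost k α c≤k))

  cost<1⇒free : ∀ {X Y c} → Alignment w X Y c → c <ℚ 1ℚ → length X ≡ length Y × c ≡ 0ℚ
  cost<1⇒free nil _ = refl , refl
  cost<1⇒free (del {a = a} α) c<1 = ⊥-elim (1≤p⇒p≮1 (1≤p+q (del-cost a) (cost-nonneg α)) c<1)
  cost<1⇒free (ins {b = b} α) c<1 = ⊥-elim (1≤p⇒p≮1 (1≤p+q (ins-cost b) (cost-nonneg α)) c<1)
  cost<1⇒free (sub {a = a} {b = b} {c = c} α) c<1
    with cost<1⇒free α (ℚ.≤-<-trans (p≤q+p c (w-nonneg _ _)) c<1) | w (just a) (just b) ℚ.≟ 0ℚ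
  ... | |X|≡|Y| , refl | yes wab≡0 = cong suc |X|≡|Y| , trans (cong (_+ℚ 0ℚ) wab≡0) (ℚ.+-identityʳ 0ℚ)
  ... | _              | no wab≢0  = ⊥-elim (1≤p⇒p≮1 (1≤p+q (w-ge1 _ _ a≢b) (cost-nonneg α)) c<1)
    where
    a≢b : just a ≢ just b
    a≢b a≡b = wab≢0 (trans (cong (w (just a)) (sym a≡b)) (w-refl (just a)))

  -- Pigeonhole over the first r + 1 blocks of length p: each block that is not aligned at cost 0
  -- costs at least 1, so a budget of r cannot pay for all of them.
  zeroCostWindow : ∀ p r {P Y c} → Alignment w P Y c → c ≤ℚ ℕtoℚ r → suc r * p ≤ length P →
                   ZeroCostWindow p 0 (suc r * p) P Y c
  firstBlockOrLater : ∀ p r {B P Y c} → length B ≡ p → r * p ≤ length P → c ≤ℚ ℕtoℚ r →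
                      SplitAlignment B P Y c → ZeroCostWindow p 0 (suc r * p) (B ++ P) Y c

  zeroCostWindow p r {P} {Y} {c} α c≤r 1+r*p≤ =
    subst (λ P → ZeroCostWindow p 0 (suc r * p) P Y c) (take++drop≡id p P)
      (firstBlockOrLater p r (length-take-≤ p P (ℕ.m+n≤o⇒m≤o p 1+r*p≤)) (length-drop-≥ p P 1+r*p≤) c≤r
        (splitAlignment (take p P) (subst (λ P → Alignment w P Y c) (sym (take++drop≡id p P)) α)))

  firstBlockOrLater p r |B|≡p _ c≤r s with SplitAlignment.c₁ s <? 1ℚ
  ... | yes c₁<1 = record
    { P≡ = refl ; Y≡ = Y≡ ; c≡ = trans c≡ (cong (_+ℚ c₂) c₁≡0)
    ; αˡ = nil ; β = subst (Alignment w _ _) c₁≡0 α₁ ; αʳ = α₂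
    ; length-B = |B|≡p ; length-B′ = trans (sym |B|≡|Y₁|) |B|≡p
    ; lo≤ = z≤n ; ≤hi = ℕ.m≤m+n p (r * p)
    }
    where
    open SplitAlignment s
    |B|≡|Y₁| = proj₁ (cost<1⇒free α₁ c₁<1)
    c₁≡0 = proj₂ (cost<1⇒free α₁ c₁<1)
  firstBlockOrLater p zero _ _ c≤0 s | no c₁≮1 =
    ⊥-elim (1≰0 (ℚ.≤-trans (1≤p+q (ℚ.≮⇒≥ c₁≮1) (cost-nonneg α₂)) (subst (_≤ℚ 0ℚ) c≡ c≤0)))
    where open SplitAlignment s
  firstBlockOrLater p (suc r) |B|≡p r*p≤ c≤1+r s | no c₁≮1 =
    weakenWindow z≤n (ℕ.≤-reflexive (cong (_+ suc r * p) |B|≡p))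
      (prependWindow s (zeroCostWindow p r α₂ c₂≤r r*p≤))
    where
    open SplitAlignment s
    c₂≤r : c₂ ≤ℚ ℕtoℚ r
    c₂≤r = p+q≤1+k⇒q≤k r (ℚ.≮⇒≥ c₁≮1) (subst (_≤ℚ ℕtoℚ (suc r)) c≡ c≤1+r)

  zeroCostWindowFrom : ∀ q p r {P Y c} → Alignment w P Y c → c ≤ℚ ℕtoℚ r → q + suc r * p ≤ length P →
                       ZeroCostWindow p q (q + suc r * p) P Y c
  zeroCostWindowFrom q p r {P} {Y} {c} α c≤r q+[1+r]p≤ =
    subst (λ P → ZeroCostWindow p q (q + suc r * p) P Y c) (take++drop≡id q P)
      (weakenWindow (ℕ.≤-reflexive (sym (trans (ℕ.+-identityʳ _) |take|)))
                    (ℕ.≤-reflexive (cong (_+ suc r * p) |take|))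
        (prependWindow s (zeroCostWindow p r α₂ c₂≤r (length-drop-≥ q P q+[1+r]p≤))))
    where
    |take| : length (take q P) ≡ q
    |take| = length-take-≤ q P (ℕ.m+n≤o⇒m≤o q q+[1+r]p≤)
    s = splitAlignment (take q P) (subst (λ P → Alignment w P Y c) (sym (take++drop≡id q P)) α)
    open SplitAlignment s
    c₂≤r : c₂ ≤ℚ ℕtoℚ r
    c₂≤r = ℚ.≤-trans (p≤q+p c₂ (cost-nonneg α₁)) (subst (_≤ℚ ℕtoℚ r) c≡ c≤r)

  pumpable : ∀ (GP S CP GT CT : List A) k p h h′ →
             length GT + k ≤ length GP + h → length CT + k ≤ length CP + h′ → h + suc k * p + h′ ≤ length S →
             ∀ i → Occ w k (GP ++ S ++ CP) (GT ++ S ++ CT) i → PumpableOccurrence k p GP S CP GT CT i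
  pumpable GP S CP GT CT k p h h′ GT≤GP CT≤CP fits i (j , i≤j , j≤|T| , c , α , c≤k) = record
    { Pˡ = Pˡ ; B = B ; Pʳ = Pʳ ; Tˡ = Tᵢ ++ Yˡ ; B′ = B′ ; Tʳ = Yʳ ++ Tⱼ
    ; P≡ = P≡ ; T≡ = T≡ ; length-B = length-B ; length-B′ = length-B′
    ; GP≤Pˡ = ℕ.≤-trans (ℕ.m≤m+n (length GP) h) lo≤
    ; CP≤Pʳ = ℕ.m+n≤o⇒m≤o (length CP) CP+h′≤Pʳ
    ; GT≤Tˡ = ℕ.≤-trans (margin-transfer k αˡ cˡ≤k (ℕ.≤-trans GT≤GP lo≤)) (length-++-≤ʳ Yˡ {Tᵢ})
    ; CT≤Tʳ = ℕ.≤-trans (margin-transfer k αʳ cʳ≤k (ℕ.≤-trans CT≤CP CP+h′≤Pʳ)) (length-++-≤ˡ Yʳ)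
    ; deleted = factor⇒Occ {k = k} {Tˡ = Tᵢ}
        (solve 4 (λ a b c d → (a ⊕ b) ⊕ c ⊕ d ⊜ a ⊕ (b ⊕ c) ⊕ d) refl Tᵢ Yˡ Yʳ Tⱼ)
        |Tᵢ| (c , deleteWindow , c≤k)
    ; doubled = factor⇒Occ {k = k} {Tˡ = Tᵢ}
        (solve 5 (λ a b e c d → (a ⊕ b) ⊕ e ⊕ e ⊕ c ⊕ d ⊜ a ⊕ (b ⊕ e ⊕ e ⊕ c) ⊕ d) refl Tᵢ Yˡ B′ Yʳ Tⱼ)
        |Tᵢ| (c , doubleWindow , c≤k)
    }
    where
    open ++-Solver A using (solve; _⊜_; _⊕_)
    T = GT ++ S ++ CT
    Tᵢ = take i T
    Tⱼ = drop j T
    q = length GP + h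

    q+[1+k]p≤|P| : q + suc k * p ≤ length (GP ++ S ++ CP)
    q+[1+k]p≤|P| = begin
      (length GP + h) + suc k * p        ≡⟨ ℕ.+-assoc (length GP) h _ ⟩
      length GP + (h + suc k * p)        ≤⟨ ℕ.+-monoʳ-≤ (length GP)
                                              (ℕ.≤-trans (ℕ.m≤m+n _ h′) (ℕ.≤-trans fits (ℕ.m≤m+n _ (length CP)))) ⟩
      length GP + (length S + length CP) ≡⟨ sym (length-++₃ GP S CP) ⟩
      length (GP ++ S ++ CP)             ∎
      where open ℕ.≤-Reasoning

    open ZeroCostWindow (zeroCostWindowFrom q p k α c≤k q+[1+k]p≤|P|)

    cˡ≤k : cˡ ≤ℚ ℕtoℚ k
    cˡ≤k = ℚ.≤-trans (p≤p+q cˡ (cost-nonneg αʳ)) (subst (_≤ℚ ℕtoℚ k) c≡ c≤k)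
    cʳ≤k : cʳ ≤ℚ ℕtoℚ k
    cʳ≤k = ℚ.≤-trans (p≤q+p cʳ (cost-nonneg αˡ)) (subst (_≤ℚ ℕtoℚ k) c≡ c≤k)

    CP+h′≤Pʳ : length CP + h′ ≤ length Pʳ
    CP+h′≤Pʳ = window-suffix-margin GP S CP Pˡ B Pʳ P≡
      (subst (λ n → length Pˡ + n ≤ _) (sym length-B)
             (ℕ.≤-trans ≤hi (ℕ.≤-reflexive (ℕ.+-assoc (length GP) h _))))
      fits

    |Tᵢ| : length Tᵢ ≡ i
    |Tᵢ| = length-take-≤ i T (ℕ.≤-trans i≤j j≤|T|)
    T≡ : T ≡ (Tᵢ ++ Yˡ) ++ B′ ++ (Yʳ ++ Tⱼ)
    T≡ = trans (slice-factor T i≤j j≤|T|)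
           (trans (cong (λ Y → Tᵢ ++ Y ++ Tⱼ) Y≡)
                  (solve 5 (λ a b e c d → a ⊕ (b ⊕ e ⊕ c) ⊕ d ⊜ (a ⊕ b) ⊕ e ⊕ (c ⊕ d)) refl Tᵢ Yˡ B′ Yʳ Tⱼ))

-- Pumping a periodic middle part

module Pumping {A : Set} {w : Weight A} {W : ℚ} (normalized : NormalizedBy w W)
               {u v : List A} (S : ℕ → List A)
               (S-suc : ∀ m → S (suc m) ≡ u ++ S m) (conj₀ : u ++ S 0 ≡ S 0 ++ v) where

  conj : ∀ m → u ++ S m ≡ S m ++ v
  conj zero    = conj₀
  conj (suc m) = begin
    u ++ S (suc m)   ≡⟨ cong (u ++_) (S-suc m) ⟩
    u ++ u ++ S m    ≡⟨ cong (u ++_) (conj m) ⟩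
    u ++ S m ++ v    ≡⟨ sym (++-assoc u (S m) v) ⟩
    (u ++ S m) ++ v  ≡⟨ cong (_++ v) (sym (S-suc m)) ⟩
    S (suc m) ++ v   ∎
    where open ≡-Reasoning

  occ-pump : ∀ (GP CP GT CT : List A) k h h′ m →
             length GT + k ≤ length GP + h → length CT + k ≤ length CP + h′ →
             h + suc k * length u + h′ ≤ length (S (suc m)) →
             ∀ i → Occ w k (GP ++ S (suc m) ++ CP) (GT ++ S (suc m) ++ CT) i →
             Occ w k (GP ++ S m ++ CP) (GT ++ S m ++ CT) i
             × Occ w k (GP ++ S (suc (suc m)) ++ CP) (GT ++ S (suc (suc m)) ++ CT) i
  occ-pump GP CP GT CT k h h′ m GT≤GP CT≤CP fits i occ =
      subst₂ (λ P T → Occ w k P T i)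
        (delete-middle-window GP CP Pˡ B Pʳ (conj m) (S-suc m) P≡ length-B GP≤Pˡ CP≤Pʳ)
        (delete-middle-window GT CT Tˡ B′ Tʳ (conj m) (S-suc m) T≡ length-B′ GT≤Tˡ CT≤Tʳ)
        deleted
    , subst₂ (λ P T → Occ w k P T i)
        (insert-middle-window GP CP Pˡ B Pʳ (conj (suc m)) (S-suc (suc m)) P≡ length-B GP≤Pˡ CP≤Pʳ)
        (insert-middle-window GT CT Tˡ B′ Tʳ (conj (suc m)) (S-suc (suc m)) T≡ length-B′ GT≤Tˡ CT≤Tʳ)
        doubled
    where
    open PumpableOccurrence (pumpable normalized GP (S (suc m)) CP GT CT k (length u) h h′ GT≤GP CT≤CP fits i occ)

-- Values of puzzles

module _ {A : Set} where

  lenDiff : List A → List A → ℕ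
  lenDiff U V = (length U ∸ length V) + (length V ∸ length U)

  length-≤-lenDiff : ∀ (U V : List A) → length V ≤ length U + lenDiff U V
  length-≤-lenDiff U V = ℕ.≤-trans (ℕ.m≤n+m∸n (length V) (length U))
                           (ℕ.+-monoʳ-≤ (length U) (ℕ.m≤n+m (length V ∸ length U) (length U ∸ length V)))

  length-drop-≤-lenDiff : ∀ Δ (U V : List A) → length (drop Δ V) ≤ length (drop Δ U) + lenDiff U V
  length-drop-≤-lenDiff Δ U V = begin
    length (drop Δ V)                 ≡⟨ length-drop Δ V ⟩
    length V ∸ Δ                      ≤⟨ ℕ.∸-monoˡ-≤ Δ (length-≤-lenDiff U V) ⟩
    (length U + lenDiff U V) ∸ Δ      ≤⟨ m+n∸o≤m∸o+n (length U) (lenDiff U V) Δ ⟩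
    (length U ∸ Δ) + lenDiff U V      ≡⟨ cong (_+ lenDiff U V) (sym (length-drop Δ U)) ⟩
    length (drop Δ U) + lenDiff U V   ∎
    where open ℕ.≤-Reasoning

  lenDiffSum-++ : ∀ (J K : List (List A × List A)) → lenDiffSum (J ++ K) ≡ lenDiffSum J + lenDiffSum K
  lenDiffSum-++ []             K = refl
  lenDiffSum-++ ((U , V) ∷ J) K =
    trans (cong (lenDiff U V +_) (lenDiffSum-++ J K)) (sym (ℕ.+-assoc (lenDiff U V) (lenDiffSum J) _))

  lenDiffSum-replicate : ∀ m (Q : List A) → lenDiffSum (replicate m (Q , Q)) ≡ 0
  lenDiffSum-replicate zero    Q = refl
  lenDiffSum-replicate (suc m) Q rewrite ℕ.n∸n≡0 (length Q) = lenDiffSum-replicate m Q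

  lenDiffSum-block : ∀ (L : List (List A × List A)) m Q R →
                     lenDiffSum (L ++ replicate m (Q , Q) ++ R) ≡ lenDiffSum L + lenDiffSum R
  lenDiffSum-block L m Q R = trans (lenDiffSum-++ L _) (cong (lenDiffSum L +_)
    (trans (lenDiffSum-++ (replicate m (Q , Q)) R) (cong (_+ lenDiffSum R) (lenDiffSum-replicate m Q))))

  valTail : ℕ → List (List A) → List A
  valTail Δ Ss = concat (map (drop Δ) Ss)

  valTail-++ : ∀ Δ (Ss Ts : List (List A)) → valTail Δ (Ss ++ Ts) ≡ valTail Δ Ss ++ valTail Δ Ts
  valTail-++ Δ Ss Ts = trans (cong concat (map-++ (drop Δ) Ss Ts)) (sym (concat-++ (map (drop Δ) Ss) _))

  valTail-replicate : ∀ Δ m (Q : List A) → valTail Δ (replicate m Q) ≡ concat (replicate m (drop Δ Q))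
  valTail-replicate Δ m Q = cong concat (map-replicate (drop Δ) m Q)

  length-++-≤-+ : ∀ {d e} (X Y X′ Y′ : List A) → length X′ ≤ length X + d → length Y′ ≤ length Y + e →
                  length (X′ ++ Y′) ≤ length (X ++ Y) + (d + e)
  length-++-≤-+ {d} {e} X Y X′ Y′ X′≤ Y′≤ = begin
    length (X′ ++ Y′)                       ≡⟨ length-++ X′ ⟩
    length X′ + length Y′                   ≤⟨ ℕ.+-mono-≤ X′≤ Y′≤ ⟩
    (length X + d) + (length Y + e)         ≡⟨ solve 4 (λ a d b e → (a :+ d) :+ (b :+ e) := (a :+ b) :+ (d :+ e))
                                                     refl (length X) d (length Y) e ⟩
    (length X + length Y) + (d + e)         ≡⟨ cong (_+ (d + e)) (sym (length-++ X)) ⟩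
    length (X ++ Y) + (d + e)               ∎
    where
    open ℕ.≤-Reasoning
    open +-*-Solver using (solve; _:=_; _:+_)

  length-valTail-≤ : ∀ Δ (J : List (List A × List A)) →
                     length (valTail Δ (map proj₂ J)) ≤ length (valTail Δ (map proj₁ J)) + lenDiffSum J
  length-valTail-≤ Δ []             = z≤n
  length-valTail-≤ Δ ((U , V) ∷ J) =
    length-++-≤-+ (drop Δ U) _ (drop Δ V) _ (length-drop-≤-lenDiff Δ U V) (length-valTail-≤ Δ J)

  length-val-≤ : ∀ Δ U V (J : List (List A × List A)) →
                 length (val Δ (V ∷ map proj₂ J)) ≤
                 length (val Δ (U ∷ map proj₁ J)) + lenDiffSum ((U , V) ∷ J)
  length-val-≤ Δ U V J = length-++-≤-+ U _ V _ (length-≤-lenDiff U V) (length-valTail-≤ Δ J)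

  overlap-split : ∀ {Δ} (S : List A) {T} → drop (length S ∸ Δ) S ≡ take Δ T →
                  S ≡ take (length S ∸ Δ) S ++ take Δ T
  overlap-split {Δ} S overlap≡ =
    trans (sym (take++drop≡id (length S ∸ Δ) S)) (cong (take (length S ∸ Δ) S ++_) overlap≡)

  chain-overlap : ∀ {Δ} (Ys : List (List A)) S T Zs → Chain Δ (Ys ++ S ∷ T ∷ Zs) →
                  Δ ≤ length S × drop (length S ∸ Δ) S ≡ take Δ T
  chain-overlap []            S T Zs (cons Δ≤|S| overlap≡ _) = Δ≤|S| , overlap≡
  chain-overlap (Y ∷ [])      S T Zs (cons _ _ chain)         = chain-overlap [] S T Zs chain
  chain-overlap (Y ∷ Y′ ∷ Ys) S T Zs (cons _ _ chain)         = chain-overlap (Y′ ∷ Ys) S T Zs chain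

  val-ends-with-overlap : ∀ {Δ} S Ls Q Zs → Chain Δ ((S ∷ Ls) ++ Q ∷ Zs) →
                          ∃[ G ] val Δ (S ∷ Ls) ≡ G ++ take Δ Q
  val-ends-with-overlap {Δ} S [] Q Zs (cons _ overlap≡ _) =
    take (length S ∸ Δ) S , trans (++-identityʳ S) (overlap-split S overlap≡)
  val-ends-with-overlap {Δ} S (T ∷ Ls) Q Zs (cons _ overlap≡ chain)
    with val-ends-with-overlap T Ls Q Zs chain
  ... | G , TLs≡GQ = S₀ ++ G , (begin
    S ++ drop Δ T ++ valTail Δ Ls                ≡⟨ cong (_++ drop Δ T ++ valTail Δ Ls) (overlap-split S overlap≡) ⟩
    (S₀ ++ take Δ T) ++ drop Δ T ++ valTail Δ Ls ≡⟨ solve 4 (λ s a b t → (s ⊕ a) ⊕ b ⊕ t ⊜ s ⊕ (a ⊕ b) ⊕ t)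
                                                          refl S₀ (take Δ T) (drop Δ T) (valTail Δ Ls) ⟩
    S₀ ++ (take Δ T ++ drop Δ T) ++ valTail Δ Ls ≡⟨ cong (λ Z → S₀ ++ Z ++ valTail Δ Ls) (take++drop≡id Δ T) ⟩
    S₀ ++ val Δ (T ∷ Ls)                         ≡⟨ cong (S₀ ++_) TLs≡GQ ⟩
    S₀ ++ G ++ take Δ Q                          ≡⟨ sym (++-assoc S₀ G _) ⟩
    (S₀ ++ G) ++ take Δ Q                        ∎)
    where
    open ≡-Reasoning
    open ++-Solver A using (solve; _⊜_; _⊕_)
    S₀ = take (length S ∸ Δ) S

-- Runs of plain pairs

module PlainRun {A : Set} (Δ : ℕ) (Q̂ : List A) where

  p : ℕ
  p = length Q̂ ∸ Δ

  u v : List A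
  u = take p Q̂
  v = drop Δ Q̂

  -- What a run of m copies of Q̂ contributes to val, together with the overlap Q̂[0..Δ) it shares
  -- with the preceding piece.
  periodic : ℕ → List A
  periodic m = take Δ Q̂ ++ concat (replicate m v)

  module _ (border : drop p Q̂ ≡ take Δ Q̂) where

    u++Δ-prefix : u ++ take Δ Q̂ ≡ take Δ Q̂ ++ v
    u++Δ-prefix = trans (cong (u ++_) (sym border)) (trans (take++drop≡id p Q̂) (sym (take++drop≡id Δ Q̂)))

    periodic-suc : ∀ m → periodic (suc m) ≡ u ++ periodic m
    periodic-suc m = begin
      take Δ Q̂ ++ v ++ V   ≡⟨ sym (++-assoc (take Δ Q̂) v V) ⟩
      (take Δ Q̂ ++ v) ++ V ≡⟨ cong (_++ V) (sym u++Δ-prefix) ⟩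
      (u ++ take Δ Q̂) ++ V ≡⟨ ++-assoc u (take Δ Q̂) V ⟩
      u ++ take Δ Q̂ ++ V   ∎
      where
      open ≡-Reasoning
      V = concat (replicate m v)

    periodic-conj : u ++ periodic 0 ≡ periodic 0 ++ v
    periodic-conj = trans (cong (u ++_) (++-identityʳ _)) (trans u++Δ-prefix (cong (_++ v) (sym (++-identityʳ _))))

  length-periodic : Δ ≤ length Q̂ → ∀ m → length (periodic m) ≡ Δ + m * p
  length-periodic Δ≤|Q̂| m = trans (length-++ (take Δ Q̂))
    (cong₂ _+_ (length-take-≤ Δ Q̂ Δ≤|Q̂|) (trans (length-concat-replicate m v) (cong (m *_) (length-drop Δ Q̂))))

  val-run : ∀ S Ls {G} → val Δ (S ∷ Ls) ≡ G ++ take Δ Q̂ →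
            ∀ m Rs → val Δ ((S ∷ Ls) ++ replicate m Q̂ ++ Rs) ≡ G ++ periodic m ++ valTail Δ Rs
  val-run S Ls {G} val≡ m Rs = begin
    S ++ valTail Δ (Ls ++ replicate m Q̂ ++ Rs)         ≡⟨ cong (S ++_) (valTail-++ Δ Ls _) ⟩
    S ++ valTail Δ Ls ++ valTail Δ (replicate m Q̂ ++ Rs)
      ≡⟨ cong (λ Z → S ++ valTail Δ Ls ++ Z)
              (trans (valTail-++ Δ (replicate m Q̂) Rs) (cong (_++ valTail Δ Rs) (valTail-replicate Δ m Q̂))) ⟩
    S ++ valTail Δ Ls ++ V ++ valTail Δ Rs             ≡⟨ sym (++-assoc S _ _) ⟩
    val Δ (S ∷ Ls) ++ V ++ valTail Δ Rs                ≡⟨ cong (_++ V ++ valTail Δ Rs) val≡ ⟩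
    (G ++ take Δ Q̂) ++ V ++ valTail Δ Rs               ≡⟨ solve 4 (λ g q x c → (g ⊕ q) ⊕ x ⊕ c ⊜ g ⊕ (q ⊕ x) ⊕ c)
                                                                refl G (take Δ Q̂) V (valTail Δ Rs) ⟩
    G ++ periodic m ++ valTail Δ Rs                    ∎
    where
    open ≡-Reasoning
    open ++-Solver A using (solve; _⊜_; _⊕_)
    V = concat (replicate m v)

  record RunShape (f : List A × List A → List A) (L R : List (List A × List A)) : Set where
    field
      Δ≤|Q̂| : Δ ≤ length Q̂
      border : drop p Q̂ ≡ take Δ Q̂
      G : List A
      length-val : length (val Δ (map f L)) ≡ length G + Δ
      val≡ : ∀ m → val Δ (map f (L ++ replicate m (Q̂ , Q̂) ++ R)) ≡ G ++ periodic m ++ valTail Δ (map f R)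

  runShape : ∀ (f : List A × List A → List A) → f (Q̂ , Q̂) ≡ Q̂ → ∀ J₀ L R n →
             Chain Δ (map f ((J₀ ∷ L) ++ replicate (suc (suc n)) (Q̂ , Q̂) ++ R)) → RunShape f (J₀ ∷ L) R
  runShape f fQ̂≡Q̂ J₀ L R n chain = record
    { Δ≤|Q̂| = Δ≤|Q̂|
    ; border = proj₂ (chain-overlap (f J₀ ∷ map f L) Q̂ Q̂ _ chain′)
    ; G = G
    ; length-val = trans (cong length val≡G++) (trans (length-++ G) (cong (length G +_) (length-take-≤ Δ Q̂ Δ≤|Q̂|)))
    ; val≡ = λ m → trans (cong (val Δ) (map≡ m)) (val-run (f J₀) (map f L) val≡G++ m (map f R))
    }
    where
    map≡ : ∀ m → map f ((J₀ ∷ L) ++ replicate m (Q̂ , Q̂) ++ R) ≡ (f J₀ ∷ map f L) ++ replicate m Q̂ ++ map f R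
    map≡ m = cong (f J₀ ∷_)
      (trans (map-block f L m (Q̂ , Q̂) R) (cong (λ Z → map f L ++ replicate m Z ++ map f R) fQ̂≡Q̂))
    chain′ = subst (Chain Δ) (map≡ (suc (suc n))) chain
    Δ≤|Q̂| = proj₁ (chain-overlap (f J₀ ∷ map f L) Q̂ Q̂ _ chain′)
    G = proj₁ (val-ends-with-overlap (f J₀) (map f L) Q̂ _ chain′)
    val≡G++ = proj₂ (val-ends-with-overlap (f J₀) (map f L) Q̂ _ chain′)

  -- The prefixes before the run differ in length by at most DL and the alignment shifts positions by
  -- at most k, so a pattern window at offset DL + k into the periodic part (and ending DR + k before
  -- its end) is matched to a text window inside the periodic part of the text.
  run-pump : ∀ k {w : Weight A} {W : ℚ} → NormalizedBy w W → ∀ (L R : List (List A × List A)) k′ →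
    1 ≤ length L →
    let I = λ m → L ++ replicate m (Q̂ , Q̂) ++ R in
    IsPuzzle Δ (map proj₁ (I (suc k′))) → IsPuzzle Δ (map proj₂ (I (suc k′))) →
    2 * (lenDiffSum (I (suc k′)) + k) ≤ Δ → suc k ≤ k′ →
    ∀ i → OccSeq w k Δ (I (suc k′)) i → OccSeq w k Δ (I k′) i × OccSeq w k Δ (I (suc (suc k′))) i
  run-pump k {w} normalized L@((U₀ , V₀) ∷ L′) R k′@(suc k″) _ (_ , chainᵤ) (_ , chainᵥ) budget (s≤s k≤k″)
           i occ =
      subst₂ (λ P T → Occ w k P T i) (sym (Pat.val≡ k′)) (sym (Txt.val≡ k′)) (proj₁ pumped)
    , subst₂ (λ P T → Occ w k P T i) (sym (Pat.val≡ (suc (suc k′)))) (sym (Txt.val≡ (suc (suc k′))))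
             (proj₂ pumped)
    where
    module Pat = RunShape (runShape proj₁ refl (U₀ , V₀) L′ R k″ chainᵤ)
    module Txt = RunShape (runShape proj₂ refl (U₀ , V₀) L′ R k″ chainᵥ)
    DL = lenDiffSum L
    DR = lenDiffSum R

    |Gₜ|≤|Gₚ|+DL : length Txt.G ≤ length Pat.G + DL
    |Gₜ|≤|Gₚ|+DL = ℕ.+-cancelʳ-≤ Δ _ _ (begin
      length Txt.G + Δ                        ≡⟨ sym Txt.length-val ⟩
      length (val Δ (V₀ ∷ map proj₂ L′))      ≤⟨ length-val-≤ Δ U₀ V₀ L′ ⟩
      length (val Δ (U₀ ∷ map proj₁ L′)) + DL ≡⟨ cong (_+ DL) Pat.length-val ⟩
      (length Pat.G + Δ) + DL                 ≡⟨ solve 3 (λ g d l → (g :+ d) :+ l := (g :+ l) :+ d)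
                                                         refl (length Pat.G) Δ DL ⟩
      (length Pat.G + DL) + Δ                 ∎)
      where
      open ℕ.≤-Reasoning
      open +-*-Solver using (solve; _:=_; _:+_)

    fits : (DL + k) + suc k * length u + (DR + k) ≤ length (periodic (suc k′))
    fits = subst₂ (λ a b → (DL + k) + suc k * a + (DR + k) ≤ b)
             (sym (length-take-≤ p Q̂ (ℕ.m∸n≤m (length Q̂) Δ))) (sym (length-periodic Pat.Δ≤|Q̂| (suc k′)))
             (margins-fit DL DR k k′ p (lenDiffSum-block L (suc k′) Q̂ R) budget (ℕ.m≤n⇒m≤1+n k≤k″))

    pumped = Pumping.occ-pump normalized {u = u} {v = v} periodic (periodic-suc Pat.border) (periodic-conj Pat.border)
               Pat.G (valTail Δ (map proj₁ R)) Txt.G (valTail Δ (map proj₂ R)) k (DL + k) (DR + k) k′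
               (+-monoˡ-≤-+ (length Pat.G) DL k |Gₜ|≤|Gₚ|+DL) (+-monoˡ-≤-+ _ DR k (length-valTail-≤ Δ R)) fits i
               (subst₂ (λ P T → Occ w k P T i) (Pat.val≡ (suc k′)) (Txt.val≡ (suc k′)) occ)

lemma7p32 : {A : Set} (Q̂ : List A) (k Δ : ℕ) → 0 < Δ →
    (w : Weight A) (W : ℚ) → NormalizedBy w W →
    (I : List (List A × List A)) →
    IsPuzzle Δ (map proj₁ I) → IsPuzzle Δ (map proj₂ I) →
    2 * (lenDiffSum I + k) ≤ Δ →
    (Plain : ℕ → Set) →
    (∀ p → Plain p → 1 ≤ p × suc p < length I × at I p ≡ just (Q̂ , Q̂)) →
    (L X R : List (List A × List A)) (k′ : ℕ) →
    I ≡ L ++ X ++ R → length X ≡ suc k′ → suc k ≤ k′ →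
    (∀ q → q < suc k′ → Plain (length L + q)) →
    (∀ p → suc p ≡ length L → ¬ Plain p) →
    ¬ Plain (length L + suc k′) →
    ∀ i → OccSeq w k Δ I i →
      OccSeq w k Δ (L ++ take k′ X ++ R) i
        × OccSeq w k Δ (L ++ X ++ ((Q̂ , Q̂) ∷ R)) i
lemma7p32 Q̂ k Δ _ w W normalized I puzzleᵤ puzzleᵥ budget Plain plain-internal L X R k′ refl |X|≡1+k′ k<k′
          block-plain _ _ i occ
  with refl ← run⇒replicate L X R (Q̂ , Q̂) |X|≡1+k′ (λ q q< → proj₂ (proj₂ (plain-internal _ (block-plain q q<))))
  = subst (λ Y → OccSeq w k Δ (L ++ Y ++ R) i) (sym (take-replicate-suc k′ (Q̂ , Q̂))) (proj₁ pumped)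
  , subst (λ Y → OccSeq w k Δ (L ++ Y) i) (sym (replicate-++-∷ (suc k′) (Q̂ , Q̂) R)) (proj₂ pumped)
  where
  1≤|L| : 1 ≤ length L
  1≤|L| = subst (1 ≤_) (ℕ.+-identityʳ (length L)) (proj₁ (plain-internal _ (block-plain 0 (s≤s z≤n))))
  pumped = PlainRun.run-pump Δ Q̂ k normalized L R k′ 1≤|L| puzzleᵤ puzzleᵥ budget k<k′ i occ
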